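{- Let $G$ be a graph with $\kappa(G)\geq 5$ and let $H\subseteq G$ with $H\cong K_{2,3}$ such that the two $3$-valent vertices of $H$ are not adjacent in $G$. Then $G$ contains an induced path $P$ whose ends are the $3$-valent vertices of $H$, which contains no $2$-valent vertex of $H$, and such that some $P$-bridge contains at least two of the $2$-valent vertices of $H$.
   Context: All graphs are finite, simple and undirected. The $3$-valent (resp. $2$-valent) vertices of $H\cong K_{2,3}$ are those of degree $3$ (resp. $2$) in $H$. For a path $P$ in $G$, a $P$-bridge is either an edge of $G$ not in $P$ with both ends in $P$, or a connected component of $G-V(P)$. -}

module Defs where

open import Data.Nat using (ℕ; zero; suc; _≤_)
open import Data.Fin using (Fin; zero; suc; toℕ; inject₁; fromℕ)
open import Data.Fin.Subset using (Subset; _∉_; ∣_∣)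
open import Data.Bool using (Bool; true; false)
open import Data.Product using (_×_; Σ; ∃; ∃-syntax; _,_)
open import Data.Sum using (_⊎_)
open import Function.Definitions using (Injective)
open import Relation.Binary.PropositionalEquality using (_≡_; _≢_)
open import Relation.Nullary using (¬_)

record Graph (n : ℕ) : Set where
  field
    E     : Fin n → Fin n → Bool
    sym   : ∀ x y → E x y ≡ E y x
    loopless : ∀ x → E x x ≡ false

open Graph public

Adj : ∀ {n} → Graph n → Fin n → Fin n → Set
Adj G x y = E G x y ≡ true

data WalkIn {n} (G : Graph n) (U : Fin n → Set) : Fin n → Fin n → Set where
  here : ∀ {u} → U u → WalkIn G U u u
  step : ∀ {u w v} → U u → Adj G u w → WalkIn G U w v → WalkIn G U u v

ConnectedOn : ∀ {n} → Graph n → (Fin n → Set) → Set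
ConnectedOn G U = ∀ u v → U u → U v → WalkIn G U u v

-- G is k-connected: |G| > k and G - S is connected for every S with |S| < k.
-- κ(G) ≥ k iff G is k-connected.
KConnected : ∀ {n} → ℕ → Graph n → Set
KConnected {n} k G =
  suc k ≤ n × (∀ (S : Subset n) → suc ∣ S ∣ ≤ k → ConnectedOn G (λ x → x ∉ S))

IsInducedPath : ∀ {n m} → Graph n → (Fin (suc m) → Fin n) → Set
IsInducedPath {n} {m} G p =
  Injective _≡_ _≡_ p
  × (∀ (i : Fin m) → Adj G (p (inject₁ i)) (p (suc i)))
  × (∀ (i j : Fin (suc m)) → Adj G (p i) (p j) →
       toℕ i ≡ suc (toℕ j) ⊎ toℕ j ≡ suc (toℕ i))

OffPath : ∀ {n m} → (Fin (suc m) → Fin n) → Fin n → Set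
OffPath p x = ∀ i → p i ≢ x

-- Let B = {b₀, b₁, b₂}. Among induced a₁–a₂ paths P in G − B and bridges C of P
-- disjoint from B, take one with |C| maximal. If an end aᵢ has no neighbour in C, let c
-- be the vertex of P nearest to aᵢ that has one. As G − (B ∪ {c}) is connected and P is
-- induced, the part of P before c is joined to the part after it by a path through
-- G − B − P missing C; rerouting P along it releases c into a larger bridge. So both ends
-- have neighbours in C. If two b's have neighbours in C, they lie in the bridge C of P.
-- Otherwise two of them have none, and each is joined, avoiding a₁, a₂ and C, either to
-- another b (settling the claim for P) or to the interior of P, since otherwise
-- {a₁, a₂, b} would separate it from C. Then a₁ C a₂ contains an induced path P′, and the
-- interior of P, connected and disjoint from P′, puts the two b's into one bridge of P′.
module Submission where

open import Defs renaming (sym to E-sym)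
open import Data.Nat using (ℕ; zero; suc; _≤_; _<_; z≤n; s≤s; _+_)
import Data.Nat.Properties as ℕ
open import Data.Fin using (Fin; zero; suc; toℕ; inject₁; fromℕ)
open import Data.Fin.Properties using (any?) renaming (_≟_ to _≟ᶠ_)
open import Data.Fin.Subset using (Subset; ⁅_⁆; _∪_; ∣_∣)
  renaming (_∈_ to _∈ˢ_; _⊆_ to _⊆ˢ_; ⊥ to ∅)
open import Data.Fin.Subset.Properties
  using (x∈p∪q⁺; x∈p∪q⁻; p⊆p∪q; q⊆p∪q; x∈⁅x⁆; x∈⁅y⁆⇒x≡y; ∉⊥; ∣⊥∣≡0; ∣⁅x⁆∣≡1; ∣p∣≤n; p⊂q⇒∣p∣<∣q∣)
  renaming (_∈?_ to _∈ˢ?_)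
open import Data.Vec using (tabulate; []; _∷_)
open import Data.Vec.Properties using ([]=⇒lookup; lookup⇒[]=; lookup∘tabulate)
open import Data.Bool using (Bool; true; false; T)
open import Data.Bool.Properties using (T-≡) renaming (_≟_ to _≟ᵇ_)
open import Data.List using (List; []; _∷_; _++_; length; lookup; _∷ʳ_)
open import Data.List.Properties using (∷-injectiveˡ)
open import Data.List.Membership.Propositional using (_∈_; _∉_; find; lose)
open import Data.List.Membership.Propositional.Properties
  using (∈-lookup; ∈-++⁺ˡ; ∈-++⁺ʳ; ∈-++⁻)
import Data.List.Membership.DecPropositional as DecMembership
open import Data.List.Relation.Unary.Any as Any using (Any; here; there)
open import Data.List.Relation.Unary.All as All using (All; []; _∷_)
import Data.List.Relation.Unary.All.Properties as All
open import Data.Product using (_×_; Σ; ∃; ∃₂; ∃-syntax; _,_; proj₁; proj₂)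
open import Data.Sum using (_⊎_; inj₁; inj₂)
open import Data.Empty using (⊥-elim)
open import Function using (_∘_)
open import Function.Bundles using (Equivalence)
open import Function.Definitions using (Injective)
open import Relation.Nullary using (¬_; Dec; yes; no; contradiction)
open import Relation.Nullary.Decidable using (_×-dec_; _⊎-dec_; ¬?; isYes; toWitness; fromWitness; map′)
open import Relation.Unary using (Decidable)
open import Relation.Binary.PropositionalEquality
  using (_≡_; _≢_; refl; sym; trans; cong; subst)

bounded-ascent : ∀ {a r} {A : Set a} {R : Set r} (μ : A → ℕ) {bound : ℕ} →
                 (∀ s → μ s ≤ bound) → (∀ s → R ⊎ Σ A λ s′ → μ s < μ s′) → A → R
bounded-ascent {A = A} {R} μ {bound} μ≤ improve s = go (suc bound) s (s≤s (ℕ.m≤m+n bound (μ s)))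
  where
  go : (fuel : ℕ) (s : A) → bound < fuel + μ s → R
  go zero    s bd = contradiction bd (ℕ.≤⇒≯ (μ≤ s))
  go (suc k) s bd with improve s
  ... | inj₁ r = r
  ... | inj₂ (s′ , μs<μs′) = go k s′ (ℕ.<-≤-trans bd (ℕ.≤-trans
          (ℕ.≤-reflexive (sym (ℕ.+-suc k (μ s)))) (ℕ.+-monoʳ-≤ k μs<μs′)))

∈ˢ-tabulate⁺ : ∀ {n} (f : Fin n → Bool) {y} → T (f y) → y ∈ˢ tabulate f
∈ˢ-tabulate⁺ f {y} t = lookup⇒[]= y (tabulate f) (trans (lookup∘tabulate f y) (Equivalence.to T-≡ t))

∈ˢ-tabulate⁻ : ∀ {n} (f : Fin n → Bool) {y} → y ∈ˢ tabulate f → T (f y)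
∈ˢ-tabulate⁻ f {y} y∈ = Equivalence.from T-≡ (trans (sym (lookup∘tabulate f y)) ([]=⇒lookup y∈))

∣p∪q∣≤∣p∣+∣q∣ : ∀ {n} (p q : Subset n) → ∣ p ∪ q ∣ ≤ ∣ p ∣ + ∣ q ∣
∣p∪q∣≤∣p∣+∣q∣ []          []          = z≤n
∣p∪q∣≤∣p∣+∣q∣ (true ∷ p)  (true ∷ q)  =
  s≤s (ℕ.≤-trans (∣p∪q∣≤∣p∣+∣q∣ p q) (ℕ.≤-trans (ℕ.n≤1+n _) (ℕ.≤-reflexive (sym (ℕ.+-suc _ _)))))
∣p∪q∣≤∣p∣+∣q∣ (true ∷ p)  (false ∷ q) = s≤s (∣p∪q∣≤∣p∣+∣q∣ p q)
∣p∪q∣≤∣p∣+∣q∣ (false ∷ p) (true ∷ q)  =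
  ℕ.≤-trans (s≤s (∣p∪q∣≤∣p∣+∣q∣ p q)) (ℕ.≤-reflexive (sym (ℕ.+-suc _ _)))
∣p∪q∣≤∣p∣+∣q∣ (false ∷ p) (false ∷ q) = ∣p∪q∣≤∣p∣+∣q∣ p q

fromList : ∀ {n} → List (Fin n) → Subset n
fromList []       = ∅
fromList (x ∷ xs) = ⁅ x ⁆ ∪ fromList xs

∈-fromList⁺ : ∀ {n} {y : Fin n} {xs} → y ∈ xs → y ∈ˢ fromList xs
∈-fromList⁺ {xs = x ∷ xs} (here refl) = x∈p∪q⁺ (inj₁ (x∈⁅x⁆ x))
∈-fromList⁺ {xs = x ∷ xs} (there y∈) = x∈p∪q⁺ {p = ⁅ x ⁆} (inj₂ (∈-fromList⁺ y∈))

∈-fromList⁻ : ∀ {n} {y : Fin n} xs → y ∈ˢ fromList xs → y ∈ xs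
∈-fromList⁻ []       y∈ = contradiction y∈ ∉⊥
∈-fromList⁻ (x ∷ xs) y∈ with x∈p∪q⁻ ⁅ x ⁆ (fromList xs) y∈
... | inj₁ y∈⁅x⁆ = here (x∈⁅y⁆⇒x≡y x y∈⁅x⁆)
... | inj₂ y∈xs  = there (∈-fromList⁻ xs y∈xs)

∣fromList∣≤length : ∀ {n} (xs : List (Fin n)) → ∣ fromList xs ∣ ≤ length xs
∣fromList∣≤length {n} []       = ℕ.≤-reflexive (∣⊥∣≡0 n)
∣fromList∣≤length     (x ∷ xs) = ℕ.≤-trans (∣p∪q∣≤∣p∣+∣q∣ ⁅ x ⁆ (fromList xs))
  (ℕ.≤-trans (ℕ.≤-reflexive (cong (_+ ∣ fromList xs ∣) (∣⁅x⁆∣≡1 x))) (s≤s (∣fromList∣≤length xs)))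

infix 4 _∈?_
_∈?_ : ∀ {n} (x : Fin n) (xs : List (Fin n)) → Dec (x ∈ xs)
_∈?_ {n} = DecMembership._∈?_ (_≟ᶠ_ {n})

module Walks {n : ℕ} (G : Graph n) where

  Adj-sym : ∀ {x y} → Adj G x y → Adj G y x
  Adj-sym {x} {y} = trans (E-sym G y x)

  adj? : ∀ x y → Dec (Adj G x y)
  adj? x y = E G x y ≟ᵇ true

  Adj-irrefl : ∀ {x} → ¬ Adj G x x
  Adj-irrefl {x} xx = contradiction (trans (sym xx) (loopless G x)) λ ()

  Adj⇒≢ : ∀ {x y} → Adj G x y → x ≢ y
  Adj⇒≢ xy refl = Adj-irrefl xy

  module _ {U : Fin n → Set} where

    walk-head : ∀ {x y} → WalkIn G U x y → U x
    walk-head (here Ux)     = Ux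
    walk-head (step Ux _ _) = Ux

    walk-last : ∀ {x y} → WalkIn G U x y → U y
    walk-last (here Uy)    = Uy
    walk-last (step _ _ w) = walk-last w

    infixr 5 _++ʷ_
    _++ʷ_ : ∀ {x y z} → WalkIn G U x y → WalkIn G U y z → WalkIn G U x z
    here _     ++ʷ w′ = w′
    step u a w ++ʷ w′ = step u a (w ++ʷ w′)

    snocʷ : ∀ {x y z} → WalkIn G U x y → Adj G y z → U z → WalkIn G U x z
    snocʷ w yz Uz = w ++ʷ step (walk-last w) yz (here Uz)

    reverseʷ : ∀ {x y} → WalkIn G U x y → WalkIn G U y x
    reverseʷ (here u)      = here u
    reverseʷ (step u xw w) = snocʷ (reverseʷ w) (Adj-sym xw) u

    closed-along-walk : (Z : Fin n → Set) → (∀ {z y} → Z z → U y → Adj G z y → Z y) →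
                        ∀ {x y} → Z x → WalkIn G U x y → Z y
    closed-along-walk Z closed Zx (here _)      = Zx
    closed-along-walk Z closed Zx (step _ xw w) = closed-along-walk Z closed (closed Zx (walk-head w) xw) w

  mapʷ : ∀ {U U′ : Fin n → Set} → (∀ {z} → U z → U′ z) → ∀ {x y} → WalkIn G U x y → WalkIn G U′ x y
  mapʷ f (here u)      = here (f u)
  mapʷ f (step u xw w) = step (f u) xw (mapʷ f w)

  walk-within-reach : ∀ {U : Fin n → Set} {x y} → WalkIn G U x y →
                      WalkIn G (λ z → U z × WalkIn G U x z) x y
  walk-within-reach (here u)      = here (u , here u)
  walk-within-reach (step u xw w) =
    step (u , here u) xw (mapʷ (λ { (Uz , wz) → Uz , step u xw wz }) (walk-within-reach w))

module Component {n : ℕ} (G : Graph n) {U : Fin n → Set} (U? : Decidable U) {x : Fin n} (Ux : U x) where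
  open Walks G

  private
    Sound : Subset n → Set
    Sound R = ∀ {y} → y ∈ˢ R → WalkIn G U x y

    Closed : Subset n → Set
    Closed R = ∀ {z y} → z ∈ˢ R → U y → Adj G z y → y ∈ˢ R

    Frontier : Subset n → Fin n → Set
    Frontier R y = U y × ∃ λ z → z ∈ˢ R × Adj G z y

    frontier? : ∀ R → Decidable (Frontier R)
    frontier? R y = U? y ×-dec any? (λ z → z ∈ˢ? R ×-dec adj? z y)

    grow : Subset n → Subset n
    grow R = R ∪ tabulate (isYes ∘ frontier? R)

    grow-sound : ∀ {R} → Sound R → Sound (grow R)
    grow-sound {R} sound {y} y∈ with x∈p∪q⁻ R _ y∈
    ... | inj₁ y∈R = sound y∈R
    ... | inj₂ y∈F with toWitness (∈ˢ-tabulate⁻ (isYes ∘ frontier? R) y∈F)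
    ...   | Uy , z , z∈R , zy = snocʷ (sound z∈R) zy Uy

    frontier⊆grow : ∀ {R z y} → z ∈ˢ R → U y → Adj G z y → y ∈ˢ grow R
    frontier⊆grow {R} z∈R Uy zy =
      q⊆p∪q R _ (∈ˢ-tabulate⁺ (isYes ∘ frontier? R) (fromWitness (Uy , _ , z∈R , zy)))

    Partial : Set
    Partial = Σ (Subset n) λ R → Sound R × x ∈ˢ R

    Saturated : Set
    Saturated = Σ (Subset n) λ R → Sound R × Closed R × x ∈ˢ R

    grow-or-stop : (R : Partial) → Saturated ⊎ Σ Partial λ R′ → ∣ proj₁ R ∣ < ∣ proj₁ R′ ∣
    grow-or-stop (R , sound , x∈R) with any? (λ y → y ∈ˢ? grow R ×-dec ¬? (y ∈ˢ? R))
    ... | no stable = inj₁ (R , sound , closed , x∈R)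
      where
      closed : Closed R
      closed {y = y} z∈R Uy zy with y ∈ˢ? R
      ... | yes y∈R = y∈R
      ... | no  y∉R = contradiction (y , frontier⊆grow z∈R Uy zy , y∉R) stable
    ... | yes (y , y∈grow , y∉R) =
      inj₂ ((grow R , grow-sound sound , p⊆p∪q _ x∈R) , p⊂q⇒∣p∣<∣q∣ (p⊆p∪q _ , y , y∈grow , y∉R))

    saturated : Saturated
    saturated = bounded-ascent (∣_∣ ∘ proj₁) (∣p∣≤n ∘ proj₁) grow-or-stop
                  (⁅ x ⁆ , (λ y∈ → subst (WalkIn G U x) (sym (x∈⁅y⁆⇒x≡y x y∈)) (here Ux)) , x∈⁅x⁆ x)

  component : Subset n
  component = proj₁ saturated

  component-sound : ∀ {y} → y ∈ˢ component → WalkIn G U x y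
  component-sound = proj₁ (proj₂ saturated)

  component-complete : ∀ {y} → WalkIn G U x y → y ∈ˢ component
  component-complete =
    closed-along-walk (_∈ˢ component) (proj₁ (proj₂ (proj₂ saturated))) (proj₂ (proj₂ (proj₂ saturated)))

walk? : ∀ {n} (G : Graph n) {U : Fin n → Set} → Decidable U → ∀ x y → Dec (WalkIn G U x y)
walk? G U? x y with U? x
... | no ¬Ux = no (¬Ux ∘ Walks.walk-head G)
... | yes Ux with y ∈ˢ? Component.component G U? Ux
...   | yes y∈C = yes (Component.component-sound G U? Ux y∈C)
...   | no  y∉C = no (y∉C ∘ Component.component-complete G U? Ux)

module Connectivity {n k : ℕ} (G : Graph n) (κ : KConnected k G) where
  open Walks G

  connected-avoiding : (S : List (Fin n)) → length S < k → ∀ {x t} → x ∉ S → t ∉ S →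
                       WalkIn G (_∉ S) x t
  connected-avoiding S |S|<k {x} {t} x∉S t∉S =
    mapʷ (_∘ ∈-fromList⁺) (proj₂ κ (fromList S) (ℕ.<-≤-trans (s≤s (∣fromList∣≤length S)) |S|<k) x t
      (x∉S ∘ ∈-fromList⁻ S) (t∉S ∘ ∈-fromList⁻ S))

  spread : (S : List (Fin n)) → length S < k → (Z : Fin n → Set) →
           (∀ {z y} → Z z → Adj G z y → y ∉ S → Z y) →
           ∀ {x t} → Z x → x ∉ S → t ∉ S → Z t
  spread S |S|<k Z closed Zx x∉S t∉S =
    closed-along-walk Z (λ Zz y∉S zy → closed Zz zy y∉S) Zx (connected-avoiding S |S|<k x∉S t∉S)

  neighbour-outside : (S : List (Fin n)) → length S < k → ∀ {v t} → v ∉ S → t ∉ S → v ≢ t →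
                      ∃ λ w → Adj G v w × w ∉ S
  neighbour-outside S |S|<k {v} v∉S t∉S v≢t with any? (λ w → adj? v w ×-dec ¬? (w ∈? S))
  ... | yes found = found
  ... | no none = contradiction (sym (spread S |S|<k (_≡ v) stuck refl v∉S t∉S)) v≢t
    where
    stuck : ∀ {z y} → z ≡ v → Adj G z y → y ∉ S → y ≡ v
    stuck refl vy y∉S = contradiction (_ , vy , y∉S) none

module _ {A : Set} where

  data Last : List A → A → Set where
    last-single : ∀ {v} → Last (v ∷ []) v
    last-cons   : ∀ {x xs v} → Last xs v → Last (x ∷ xs) v

  last-∈ : ∀ {L v} → Last L v → v ∈ L
  last-∈ last-single   = here refl
  last-∈ (last-cons l) = there (last-∈ l)

  last-suffix : ∀ xs {y ys v} → Last (xs ++ y ∷ ys) v → Last (y ∷ ys) v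
  last-suffix []            l             = l
  last-suffix (x ∷ [])      (last-cons l) = l
  last-suffix (x ∷ x′ ∷ xs) (last-cons l) = last-suffix (x′ ∷ xs) l

  last-singleton : ∀ {x v} → Last (x ∷ []) v → x ≡ v
  last-singleton last-single = refl

  Last⇒∷ʳ : ∀ {L v} → Last L v → ∃ λ K → L ≡ K ∷ʳ v
  Last⇒∷ʳ last-single = [] , refl
  Last⇒∷ʳ (last-cons {x = x} l) with Last⇒∷ʳ l
  ... | K , refl = x ∷ K , refl

  record Split (P : A → Set) (L : List A) : Set where
    constructor split
    field
      pre   : List A
      pivot : A
      post  : List A
      eq    : L ≡ pre ++ pivot ∷ post
      holds : P pivot

  first-split : ∀ {P : A → Set} → Decidable P → ∀ L →
                All (¬_ ∘ P) L ⊎ Σ (Split P L) (All (¬_ ∘ P) ∘ Split.pre)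
  first-split P? [] = inj₁ []
  first-split P? (x ∷ xs) with P? x
  ... | yes Px = inj₂ (split [] x xs refl Px , [])
  ... | no ¬Px with first-split P? xs
  ...   | inj₁ none = inj₁ (¬Px ∷ none)
  ...   | inj₂ (split pre c post refl Pc , before) = inj₂ (split (x ∷ pre) c post refl Pc , ¬Px ∷ before)

  head∈pre : ∀ {P : A → Set} {h t} (s : Split P (h ∷ t)) → ¬ P h → h ∈ Split.pre s
  head∈pre (split []      c post eq Pc) ¬Ph = contradiction (subst _ (sym (∷-injectiveˡ eq)) Pc) ¬Ph
  head∈pre (split (_ ∷ _) c post eq Pc) ¬Ph = here (∷-injectiveˡ eq)

  last∈post : ∀ {P : A → Set} {L v} (s : Split P L) → Last L v → ¬ P v → v ∈ Split.post s
  last∈post (split pre c post refl Pc) l ¬Pv with last-suffix pre l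
  ... | last-single  = contradiction Pc ¬Pv
  ... | last-cons l′ = last-∈ l′

  last-split : ∀ {P : A → Set} → Decidable P → ∀ L →
               All (¬_ ∘ P) L ⊎ Σ (Split P L) (All (¬_ ∘ P) ∘ Split.post)
  last-split P? [] = inj₁ []
  last-split P? (x ∷ xs) with last-split P? xs
  ... | inj₂ (split pre c post refl Pc , after) = inj₂ (split (x ∷ pre) c post refl Pc , after)
  ... | inj₁ none with P? x
  ...   | yes Px  = inj₂ (split [] x xs refl Px , none)
  ...   | no  ¬Px = inj₁ (¬Px ∷ none)

module InducedPaths {n : ℕ} (G : Graph n) where
  open Walks G

  data Chordless : List (Fin n) → Set where
    single : ∀ {v} → Chordless (v ∷ [])
    cons   : ∀ {u x xs} → Adj G u x → u ∉ x ∷ xs → All (¬_ ∘ Adj G u) xs →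
             Chordless (x ∷ xs) → Chordless (u ∷ x ∷ xs)

  record InducedPath (U : Fin n → Set) (u v : Fin n) : Set where
    constructor inducedPath
    field
      rest      : List (Fin n)
      chordless : Chordless (u ∷ rest)
      last      : Last (u ∷ rest) v
      within    : All U (u ∷ rest)

  chordless-head∉ : ∀ {h t} → Chordless (h ∷ t) → h ∉ t
  chordless-head∉ (cons _ h∉ _ _) h∈ = h∉ h∈

  chordless-prefix : ∀ x xs {ys} → Chordless ((x ∷ xs) ++ ys) → Chordless (x ∷ xs)
  chordless-prefix x []        _                  = single
  chordless-prefix x (x′ ∷ xs) (cons xx′ x∉ ¬adj ch) =
    cons xx′ (x∉ ∘ ∈-++⁺ˡ) (All.++⁻ˡ xs ¬adj) (chordless-prefix x′ xs ch)

  chordless-suffix : ∀ xs {y ys} → Chordless (xs ++ y ∷ ys) → Chordless (y ∷ ys)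
  chordless-suffix []            ch                = ch
  chordless-suffix (x ∷ [])      (cons _ _ _ ch) = ch
  chordless-suffix (x ∷ x′ ∷ xs) (cons _ _ _ ch) = chordless-suffix (x′ ∷ xs) ch

  pivot∉pre : ∀ pre {c post} → Chordless (pre ++ c ∷ post) → c ∉ pre
  pivot∉pre (x ∷ [])       (cons _ x∉ _ _)  (here refl) = x∉ (here refl)
  pivot∉pre (x ∷ x′ ∷ pre) (cons _ x∉ _ _)  (here refl) = x∉ (there (∈-++⁺ʳ pre (here refl)))
  pivot∉pre (x ∷ x′ ∷ pre) (cons _ _ _ ch) (there c∈)  = pivot∉pre (x′ ∷ pre) ch c∈

  pivot∉post : ∀ pre {c post} → Chordless (pre ++ c ∷ post) → c ∉ post
  pivot∉post pre ch = chordless-head∉ (chordless-suffix pre ch)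

  no-chord-across : ∀ pre {c post u w} → Chordless (pre ++ c ∷ post) → u ∈ pre → w ∈ post → ¬ Adj G u w
  no-chord-across (x ∷ [])       (cons _ _ ¬adj _) (here refl) w∈ = All.lookup ¬adj w∈
  no-chord-across (x ∷ x′ ∷ pre) (cons _ _ ¬adj _) (here refl) w∈ = All.lookup ¬adj (∈-++⁺ʳ pre (there w∈))
  no-chord-across (x ∷ x′ ∷ pre) (cons _ _ _ ch)   (there u∈)  w∈ = no-chord-across (x′ ∷ pre) ch u∈ w∈

  walk-from-head : ∀ {h t u} → Chordless (h ∷ t) → u ∈ h ∷ t → WalkIn G (_∈ h ∷ t) h u
  walk-from-head ch                (here refl) = here (here refl)
  walk-from-head (cons hx _ _ ch) (there u∈)  = step (here refl) hx (mapʷ there (walk-from-head ch u∈))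

  walk-along : ∀ {L u u′} → Chordless L → u ∈ L → u′ ∈ L → WalkIn G (_∈ L) u u′
  walk-along {_ ∷ _} ch u∈ u′∈ = reverseʷ (walk-from-head ch u∈) ++ʷ walk-from-head ch u′∈

  walk-in-pre : ∀ {h t} pre {c post u} → h ∷ t ≡ pre ++ c ∷ post → Chordless (h ∷ t) →
                u ∈ pre → WalkIn G (_∈ pre) h u
  walk-in-pre (p ∷ pre) refl ch u∈ = walk-from-head (chordless-prefix p pre ch) u∈

  walk-in-post : ∀ pre {c post w v} → Chordless (pre ++ c ∷ post) → Last (pre ++ c ∷ post) v →
                 w ∈ post → WalkIn G (_∈ post) w v
  walk-in-post pre ch la w∈ with chordless-suffix pre ch | last-suffix pre la
  walk-in-post pre ch la () | single | _
  ... | cons _ _ _ ch′ | last-cons la′ = walk-along ch′ w∈ (last-∈ la′)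

  Contact : Fin n → Fin n → Set
  Contact u z = z ≡ u ⊎ Adj G u z

  contact? : ∀ u → Decidable (Contact u)
  contact? u z = z ≟ᶠ u ⊎-dec adj? u z

  walk⇒inducedPath : ∀ {U : Fin n → Set} {u v} → WalkIn G U u v → InducedPath U u v
  walk⇒inducedPath (here Uu) = inducedPath [] single last-single (Uu ∷ [])
  walk⇒inducedPath {U} {u} {v} (step Uu uw w) with walk⇒inducedPath w
  ... | inducedPath rest ch la al with last-split (contact? u) (_ ∷ rest)
  ...   | inj₁ (no-contact ∷ _) = contradiction (inj₂ uw) no-contact
  ...   | inj₂ (split pre c post eq contact , apart) = shorten contact
    where
    ch′ : Chordless (c ∷ post)
    ch′ = chordless-suffix pre (subst Chordless eq ch)
    la′ : Last (c ∷ post) v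
    la′ = last-suffix pre (subst (λ L → Last L v) eq la)
    al′ : All U (c ∷ post)
    al′ = All.++⁻ʳ pre (subst (All U) eq al)
    shorten : Contact u c → InducedPath U u v
    shorten (inj₁ c≡u) = subst (λ z → InducedPath U z v) c≡u (inducedPath post ch′ la′ al′)
    shorten (inj₂ uc)  =
      inducedPath (c ∷ post) (cons uc u∉ (All.map (_∘ inj₂) apart) ch′) (last-cons la′) (Uu ∷ al′)
      where
      u∉ : u ∉ c ∷ post
      u∉ (here u≡c) = Adj⇒≢ uc u≡c
      u∉ (there u∈) = All.lookup apart u∈ (inj₁ refl)

  lookup-injective : ∀ {L} → Chordless L → ∀ i j → lookup L i ≡ lookup L j → i ≡ j
  lookup-injective single           zero    zero    _ = refl
  lookup-injective (cons _ _ _ _)   zero    zero    _ = refl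
  lookup-injective (cons _ u∉ _ _)  zero    (suc j) e = contradiction (subst (_∈ _) (sym e) (∈-lookup j)) u∉
  lookup-injective (cons _ u∉ _ _)  (suc i) zero    e = contradiction (subst (_∈ _) e (∈-lookup i)) u∉
  lookup-injective (cons _ _ _ ch)  (suc i) (suc j) e = cong suc (lookup-injective ch i j e)

  lookup-consecutive : ∀ {u rest} → Chordless (u ∷ rest) → ∀ (i : Fin (length rest)) →
                       Adj G (lookup (u ∷ rest) (inject₁ i)) (lookup (u ∷ rest) (suc i))
  lookup-consecutive (cons ux _ _ _)  zero    = ux
  lookup-consecutive (cons _ _ _ ch)  (suc i) = lookup-consecutive ch i

  lookup-chord : ∀ {L} → Chordless L → ∀ i j → Adj G (lookup L i) (lookup L j) →
                 toℕ i ≡ suc (toℕ j) ⊎ toℕ j ≡ suc (toℕ i)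
  lookup-chord single           zero          zero          a = contradiction a Adj-irrefl
  lookup-chord (cons _ _ _ _)   zero          zero          a = contradiction a Adj-irrefl
  lookup-chord (cons _ _ _ _)   zero          (suc zero)    a = inj₂ refl
  lookup-chord (cons _ _ ¬a _)  zero          (suc (suc k)) a = contradiction a (All.lookup ¬a (∈-lookup k))
  lookup-chord (cons _ _ _ _)   (suc zero)    zero          a = inj₁ refl
  lookup-chord (cons _ _ ¬a _)  (suc (suc k)) zero          a =
    contradiction (Adj-sym a) (All.lookup ¬a (∈-lookup k))
  lookup-chord (cons _ _ _ ch)  (suc i)       (suc j)       a with lookup-chord ch i j a
  ... | inj₁ e = inj₁ (cong suc e)
  ... | inj₂ e = inj₂ (cong suc e)

  lookup-last : ∀ {u v : Fin n} {rest} → Last (u ∷ rest) v → lookup (u ∷ rest) (fromℕ (length rest)) ≡ v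
  lookup-last {rest = []}    last-single       = refl
  lookup-last {rest = _ ∷ _} (last-cons l)     = lookup-last l

  chordless⇒IsInducedPath : ∀ {u rest} → Chordless (u ∷ rest) → IsInducedPath G (lookup (u ∷ rest))
  chordless⇒IsInducedPath ch = (λ {i} {j} → lookup-injective ch i j) , lookup-consecutive ch , lookup-chord ch

  Interior : Fin n → Fin n → List (Fin n) → Fin n → Set
  Interior s t L z = z ∈ L × z ≢ s × z ≢ t

  interior-connected : ∀ {s t rest q q′} → Chordless (s ∷ rest) → Last (s ∷ rest) t →
                       Interior s t (s ∷ rest) q → Interior s t (s ∷ rest) q′ →
                       WalkIn G (Interior s t (s ∷ rest)) q q′
  interior-connected {s} {t} ch la (q∈ , q≢s , q≢t) (q′∈ , q′≢s , q′≢t) with Last⇒∷ʳ la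
  ... | []     , refl = contradiction (one q∈) q≢s
    where
    one : ∀ {z} → z ∈ s ∷ [] → z ≡ s
    one (here e) = e
  ... | _ ∷ [] , refl = contradiction q∈ λ { (here e) → q≢s e ; (there (here e)) → q≢t e }
  ... | _ ∷ k ∷ K , refl = mapʷ to-interior (walk-along inner (inner-∈ q∈ q≢s q≢t) (inner-∈ q′∈ q′≢s q′≢t))
    where
    ch-tail : Chordless ((k ∷ K) ∷ʳ t)
    ch-tail = chordless-suffix (s ∷ []) ch
    inner : Chordless (k ∷ K)
    inner = chordless-prefix k K ch-tail
    inner-∈ : ∀ {z} → z ∈ s ∷ (k ∷ K) ∷ʳ t → z ≢ s → z ≢ t → z ∈ k ∷ K
    inner-∈ (here e)  z≢s _ = contradiction e z≢s
    inner-∈ (there z∈) _ z≢t with ∈-++⁻ (k ∷ K) z∈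
    ... | inj₁ z∈K        = z∈K
    ... | inj₂ (here z≡t) = contradiction z≡t z≢t
    to-interior : ∀ {z} → z ∈ k ∷ K → Interior s t (s ∷ (k ∷ K) ∷ʳ t) z
    to-interior z∈ = there (∈-++⁺ˡ z∈) , (λ { refl → chordless-head∉ ch (∈-++⁺ˡ z∈) }) ,
                     (λ { refl → pivot∉pre (k ∷ K) ch-tail z∈ })

two-of-three : (Q : Fin 3 → Set) → (∀ j → Dec (Q j)) →
               (∃₂ λ j k → j ≢ k × Q j × Q k) ⊎ (∃₂ λ j k → j ≢ k × ¬ Q j × ¬ Q k)
two-of-three Q Q? with Q? zero | Q? (suc zero) | Q? (suc (suc zero))
... | yes p | yes q | _     = inj₁ (zero , suc zero , (λ ()) , p , q)
... | yes p | no q  | yes r = inj₁ (zero , suc (suc zero) , (λ ()) , p , r)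
... | yes p | no q  | no r  = inj₂ (suc zero , suc (suc zero) , (λ ()) , q , r)
... | no p  | yes q | yes r = inj₁ (suc zero , suc (suc zero) , (λ ()) , q , r)
... | no p  | yes q | no r  = inj₂ (zero , suc (suc zero) , (λ ()) , p , r)
... | no p  | no q  | _     = inj₂ (zero , suc zero , (λ ()) , p , q)

module Bridging {n : ℕ} (G : Graph n) (κ : KConnected 5 G) (a₁ a₂ : Fin n) (b : Fin 3 → Fin n)
  (a₁≢a₂ : a₁ ≢ a₂) (a₁∉b : ∀ j → a₁ ≢ b j) (a₂∉b : ∀ j → a₂ ≢ b j) (¬a₁a₂ : ¬ Adj G a₁ a₂) where

  open Walks G
  open InducedPaths G
  open Connectivity G κ

  B : List (Fin n)
  B = b zero ∷ b (suc zero) ∷ b (suc (suc zero)) ∷ []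

  b∈B : ∀ j → b j ∈ B
  b∈B zero             = here refl
  b∈B (suc zero)       = there (here refl)
  b∈B (suc (suc zero)) = there (there (here refl))

  ∈B⇒ : ∀ {x} → x ∈ B → ∃ λ j → x ≡ b j
  ∈B⇒ (here e)                 = _ , e
  ∈B⇒ (there (here e))         = _ , e
  ∈B⇒ (there (there (here e))) = _ , e

  ∉B : ∀ {x} → (∀ j → x ≢ b j) → x ∉ B
  ∉B x∉b x∈B = let j , x≡bj = ∈B⇒ x∈B in x∉b j x≡bj

  Free : List (Fin n) → Fin n → Set
  Free L x = x ∉ B × x ∉ L

  free? : ∀ L → Decidable (Free L)
  free? L x = ¬? (x ∈? B) ×-dec ¬? (x ∈? L)

  Route : Set
  Route = InducedPath (_∉ B) a₁ a₂

  Bridged : List (Fin n) → Set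
  Bridged L = ∃₂ λ j k → j ≢ k × WalkIn G (_∉ L) (b j) (b k)

  Solution : Set
  Solution = Σ Route λ r → Bridged (a₁ ∷ InducedPath.rest r)

  -- The seed determines the bridge C of the route; |C| is the potential that increases.
  record Config : Set where
    constructor config
    field
      route     : Route
      seed      : Fin n
      seed-free : Free (a₁ ∷ InducedPath.rest route) seed

  component-of : Config → Subset n
  component-of cfg =
    Component.component G (free? (a₁ ∷ InducedPath.rest (Config.route cfg))) (Config.seed-free cfg)

  module Improve (cfg : Config) where
    open Config cfg
    open InducedPath route

    L : List (Fin n)
    L = a₁ ∷ rest

    U : Fin n → Set
    U = Free L

    InC : Fin n → Set
    InC = WalkIn G U seed

    C-sound : ∀ {z} → z ∈ˢ component-of cfg → InC z
    C-sound = Component.component-sound G (free? L) seed-free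

    ∈L⇒∉B : ∀ {z} → z ∈ L → z ∉ B
    ∈L⇒∉B = All.lookup within

    ∈L⇒∉C : ∀ {z} → z ∈ L → ¬ InC z
    ∈L⇒∉C z∈L z∈C = proj₂ (walk-last z∈C) z∈L

    b∉L : ∀ j → b j ∉ L
    b∉L j bj∈L = ∈L⇒∉B bj∈L (b∈B j)

    outside-C : ∀ {x y} → ¬ InC x → WalkIn G U x y → WalkIn G (λ z → U z × ¬ InC z) x y
    outside-C x∉C w = mapʷ (λ { (Uz , xz) → Uz , λ z∈C → x∉C (z∈C ++ʷ reverseʷ xz) }) (walk-within-reach w)

    inside-C : ∀ {x y} → InC x → WalkIn G U x y → WalkIn G InC x y
    inside-C x∈C w = mapʷ (λ { (_ , xz) → x∈C ++ʷ xz }) (walk-within-reach w)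

    within-C : ∀ {x y} → InC x → InC y → WalkIn G InC x y
    within-C x∈C y∈C = inside-C x∈C (reverseʷ x∈C ++ʷ y∈C)

    Touches : Fin n → Set
    Touches z = ∃ λ x → InC x × Adj G z x

    touches? : Decidable Touches
    touches? z = any? (λ x → walk? G (free? L) seed x ×-dec adj? z x)

    Detour : Fin n → Fin n → Set
    Detour u w = ∃₂ λ x y → Adj G u x × WalkIn G U x y × Adj G y w

    detour? : ∀ u w → Dec (Detour u w)
    detour? u w = any? λ x → any? λ y → adj? u x ×-dec walk? G (free? L) x y ×-dec adj? y w

    reverse-detour : ∀ {u w} → Detour u w → Detour w u
    reverse-detour (x , y , ux , xy , yw) = y , x , Adj-sym yw , reverseʷ xy , Adj-sym ux

    Improvement : Set
    Improvement = Solution ⊎ Σ Config λ cfg′ → ∣ component-of cfg ∣ < ∣ component-of cfg′ ∣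

    some-vertex-touches : ¬ All (¬_ ∘ Touches) L
    some-vertex-touches none =
      ∈L⇒∉C (here refl) (spread B (ℕ.m≤m+n 4 1) InC extend (here seed-free) (proj₁ seed-free) (∉B a₁∉b))
      where
      extend : ∀ {z y} → InC z → Adj G z y → y ∉ B → InC y
      extend {z} {y} z∈C zy y∉B with y ∈? L
      ... | yes y∈L = contradiction (z , z∈C , Adj-sym zy) (All.lookup none y∈L)
      ... | no  y∉L = snocʷ z∈C zy (y∉B , y∉L)

    -- Removing c and B (four vertices) would cut the side Sd off from the seed.
    untouched-side-empty : (Sd Ot : List (Fin n)) (c : Fin n) →
      (∀ {z} → z ∈ L → z ∈ Sd ⊎ z ≡ c ⊎ z ∈ Ot) → (∀ {z} → z ∈ Sd → z ∈ L) → c ∈ L → c ∉ Sd →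
      (∀ {u w} → u ∈ Sd → w ∈ Ot → ¬ Adj G u w) → (∀ {u w} → u ∈ Sd → w ∈ Ot → ¬ Detour u w) →
      All (¬_ ∘ Touches) Sd → ∀ {e} → e ∉ Sd
    untouched-side-empty Sd Ot c trichotomy Sd⊆L c∈L c∉Sd no-chord no-detour untouched {e} e∈Sd =
      excluded (spread (c ∷ B) ℕ.≤-refl Z extend (inj₁ e∈Sd) e∉ seed∉)
      where
      Z : Fin n → Set
      Z z = z ∈ Sd ⊎ ∃₂ λ u x → u ∈ Sd × Adj G u x × WalkIn G U x z

      not-across : ∀ {z y} → Z z → Adj G z y → ¬ y ∈ Ot
      not-across (inj₁ z∈Sd)                 zy y∈Ot = no-chord z∈Sd y∈Ot zy
      not-across (inj₂ (u , x , u∈Sd , ux , xz)) zy y∈Ot = no-detour u∈Sd y∈Ot (x , _ , ux , xz , zy)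

      extend : ∀ {z y} → Z z → Adj G z y → y ∉ c ∷ B → Z y
      extend {z} {y} Zz zy y∉ with y ∈? L
      ... | yes y∈L with trichotomy y∈L
      ...   | inj₁ y∈Sd        = inj₁ y∈Sd
      ...   | inj₂ (inj₁ y≡c)  = contradiction (here y≡c) y∉
      ...   | inj₂ (inj₂ y∈Ot) = contradiction y∈Ot (not-across Zz zy)
      extend {z} {y} (inj₁ z∈Sd) zy y∉ | no y∉L = inj₂ (z , y , z∈Sd , zy , here ((y∉ ∘ there) , y∉L))
      extend {z} {y} (inj₂ (u , x , u∈Sd , ux , xz)) zy y∉ | no y∉L =
        inj₂ (u , x , u∈Sd , ux , snocʷ xz zy ((y∉ ∘ there) , y∉L))

      e∉ : e ∉ c ∷ B
      e∉ (here e≡c)  = c∉Sd (subst (_∈ Sd) e≡c e∈Sd)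
      e∉ (there e∈B) = ∈L⇒∉B (Sd⊆L e∈Sd) e∈B

      seed∉ : seed ∉ c ∷ B
      seed∉ (here seed≡c)  = proj₂ seed-free (subst (_∈ L) (sym seed≡c) c∈L)
      seed∉ (there seed∈B) = proj₁ seed-free seed∈B

      excluded : ¬ Z seed
      excluded (inj₁ seed∈Sd)                = proj₂ seed-free (Sd⊆L seed∈Sd)
      excluded (inj₂ (u , x , u∈Sd , ux , xs)) = All.lookup untouched u∈Sd (x , reverseʷ xs , ux)

    module AtPivot (s : Split Touches L) where
      open Split s

      ch : Chordless (pre ++ pivot ∷ post)
      ch = subst Chordless eq chordless

      la : Last (pre ++ pivot ∷ post) a₂
      la = subst (λ K → Last K a₂) eq last

      from-split : ∀ {z} → z ∈ pre ++ pivot ∷ post → z ∈ L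
      from-split {z} = subst (z ∈_) (sym eq)

      pre⊆L : ∀ {z} → z ∈ pre → z ∈ L
      pre⊆L = from-split ∘ ∈-++⁺ˡ

      post⊆L : ∀ {z} → z ∈ post → z ∈ L
      post⊆L = from-split ∘ ∈-++⁺ʳ pre ∘ there

      pivot∈L : pivot ∈ L
      pivot∈L = from-split (∈-++⁺ʳ pre (here refl))

      trichotomy : ∀ {z} → z ∈ L → z ∈ pre ⊎ z ≡ pivot ⊎ z ∈ post
      trichotomy {z} z∈L with ∈-++⁻ pre (subst (z ∈_) eq z∈L)
      ... | inj₁ z∈pre           = inj₁ z∈pre
      ... | inj₂ (here z≡pivot)  = inj₂ (inj₁ z≡pivot)
      ... | inj₂ (there z∈post)  = inj₂ (inj₂ z∈post)

      Crossing : Set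
      Crossing = ∃₂ λ u w → u ∈ pre × w ∈ post × Detour u w

      crossing? : Dec Crossing
      crossing? = map′ found lost (Any.any? (λ u → Any.any? (detour? u) post) pre)
        where
        found : Any (λ u → Any (Detour u) post) pre → Crossing
        found c with find c
        ... | u , u∈pre , ws with find ws
        ...   | w , w∈post , d = u , w , u∈pre , w∈post , d
        lost : Crossing → Any (λ u → Any (Detour u) post) pre
        lost (u , w , u∈pre , w∈post , d) = lose u∈pre (lose w∈post d)

      -- The pivot leaves the route and seeds a bridge containing C and itself.
      reroute : ∀ {u w} → u ∈ pre → w ∈ post → (d : Detour u w) → ¬ InC (proj₁ d) →
                Σ Config λ cfg′ → ∣ component-of cfg ∣ < ∣ component-of cfg′ ∣
      reroute {u} {w} u∈pre w∈post (x , y , ux , xy , yw) x∉C =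
        config route′ pivot pivot-free , p⊂q⇒∣p∣<∣q∣ (C⊆C′ , pivot , pivot∈C′ , pivot∉C)
        where
        U′ : Fin n → Set
        U′ z = z ∉ B × ¬ InC z × z ≢ pivot

        on-route : ∀ {z} → z ∈ L → z ≢ pivot → U′ z
        on-route z∈L z≢pivot = ∈L⇒∉B z∈L , ∈L⇒∉C z∈L , z≢pivot

        to-u : WalkIn G U′ a₁ u
        to-u = mapʷ (λ z∈pre → on-route (pre⊆L z∈pre) (λ { refl → pivot∉pre pre ch z∈pre }))
                    (walk-in-pre pre eq chordless u∈pre)

        detour : WalkIn G U′ x y
        detour = mapʷ (λ { ((z∉B , z∉L) , z∉C) → z∉B , z∉C , λ { refl → z∉L pivot∈L } }) (outside-C x∉C xy)

        from-w : WalkIn G U′ w a₂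
        from-w = mapʷ (λ z∈post → on-route (post⊆L z∈post) (λ { refl → pivot∉post pre ch z∈post }))
                      (walk-in-post pre ch la w∈post)

        new : InducedPath U′ a₁ a₂
        new = walk⇒inducedPath
          (to-u ++ʷ step (walk-last to-u) ux (detour ++ʷ step (walk-last detour) yw from-w))

        open InducedPath new using () renaming (rest to rest′; within to within′)

        route′ : Route
        route′ = inducedPath rest′ (InducedPath.chordless new) (InducedPath.last new) (All.map proj₁ within′)

        L′ : List (Fin n)
        L′ = a₁ ∷ rest′

        pivot-free : Free L′ pivot
        pivot-free = ∈L⇒∉B pivot∈L , λ pivot∈L′ → proj₂ (proj₂ (All.lookup within′ pivot∈L′)) refl

        C′ : Subset n
        C′ = Component.component G (free? L′) pivot-free

        pivot∈C′ : pivot ∈ˢ C′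
        pivot∈C′ = Component.component-complete G (free? L′) pivot-free (here pivot-free)

        pivot∉C : ¬ pivot ∈ˢ component-of cfg
        pivot∉C = ∈L⇒∉C pivot∈L ∘ C-sound

        C⊆C′ : component-of cfg ⊆ˢ C′
        C⊆C′ z∈C with holds
        ... | x₀ , x₀∈C , pivot-x₀ = Component.component-complete G (free? L′) pivot-free
          (step pivot-free pivot-x₀ (mapʷ still-free (within-C x₀∈C (C-sound z∈C))))
          where
          still-free : ∀ {v} → InC v → Free L′ v
          still-free v∈C = proj₁ (walk-last v∈C) , λ v∈L′ → proj₁ (proj₂ (All.lookup within′ v∈L′)) v∈C

      from-start : All (¬_ ∘ Touches) pre → ¬ Touches a₁ → Improvement
      from-start untouched ¬t₁ with crossing?
      ... | yes (u , w , u∈pre , w∈post , d@(x , _ , ux , _)) =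
        inj₂ (reroute u∈pre w∈post d λ x∈C → All.lookup untouched u∈pre (x , x∈C , ux))
      ... | no ¬crossing = ⊥-elim (untouched-side-empty pre post pivot trichotomy pre⊆L pivot∈L
              (pivot∉pre pre ch) (no-chord-across pre ch) (λ u∈ w∈ d → ¬crossing (_ , _ , u∈ , w∈ , d))
              untouched (head∈pre s ¬t₁))

      from-end : All (¬_ ∘ Touches) post → ¬ Touches a₂ → Improvement
      from-end untouched ¬t₂ with crossing?
      ... | yes (u , w , u∈pre , w∈post , d@(x , y , _ , xy , yw)) =
        inj₂ (reroute u∈pre w∈post d λ x∈C → All.lookup untouched w∈post (y , x∈C ++ʷ xy , Adj-sym yw))
      ... | no ¬crossing = ⊥-elim (untouched-side-empty post pre pivot swapped post⊆L pivot∈L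
              (pivot∉post pre ch) (λ w∈ u∈ wu → no-chord-across pre ch u∈ w∈ (Adj-sym wu))
              (λ w∈ u∈ d → ¬crossing (_ , _ , u∈ , w∈ , reverse-detour d))
              untouched (last∈post s last ¬t₂))
        where
        swapped : ∀ {z} → z ∈ L → z ∈ post ⊎ z ≡ pivot ⊎ z ∈ pre
        swapped z∈L with trichotomy z∈L
        ... | inj₁ z∈pre          = inj₂ (inj₂ z∈pre)
        ... | inj₂ (inj₁ z≡pivot) = inj₂ (inj₁ z≡pivot)
        ... | inj₂ (inj₂ z∈post)  = inj₁ z∈post

    Avoids : Fin n → Set
    Avoids z = z ≢ a₁ × z ≢ a₂ × ¬ InC z

    interior? : Decidable (Interior a₁ a₂ L)
    interior? q = q ∈? L ×-dec ¬? (q ≟ᶠ a₁) ×-dec ¬? (q ≟ᶠ a₂)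

    interior-avoids : ∀ {z} → Interior a₁ a₂ L z → Avoids z
    interior-avoids (z∈L , z≢a₁ , z≢a₂) = z≢a₁ , z≢a₂ , ∈L⇒∉C z∈L

    free-avoids : ∀ {z} → U z × ¬ InC z → Avoids z
    free-avoids ((_ , z∉L) , z∉C) = (λ { refl → z∉L (here refl) }) , (λ { refl → z∉L (last-∈ last) }) , z∉C

    b-avoids : ∀ j → Avoids (b j)
    b-avoids j = (λ e → a₁∉b j (sym e)) , (λ e → a₂∉b j (sym e)) , λ bj∈C → proj₁ (walk-last bj∈C) (b∈B j)

    bridged : ∀ {j k} → j ≢ k → WalkIn G (_∉ L) (b j) (b k) → Solution
    bridged j≢k w = route , _ , _ , j≢k , w

    ReachesInterior : Fin n → Set
    ReachesInterior v = ∃ λ q → Interior a₁ a₂ L q × WalkIn G Avoids v q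

    -- Otherwise {a₁, a₂, b i} would separate w from the seed.
    via-free-neighbour : ∀ i {w} → Adj G (b i) w → U w → ¬ InC w → Solution ⊎ ReachesInterior (b i)
    via-free-neighbour i {w} bw Uw w∉C
      with any? (λ z → walk? G (free? L) w z ×-dec any? (λ l → ¬? (l ≟ᶠ i) ×-dec adj? (b l) z))
    ... | yes (z , wz , l , l≢i , bl-z) =
      inj₁ (bridged (l≢i ∘ sym) (step (b∉L i) bw (snocʷ (mapʷ proj₂ wz) (Adj-sym bl-z) (b∉L l))))
    ... | no ¬to-b with any? (λ z → walk? G (free? L) w z ×-dec any? (λ q → interior? q ×-dec adj? z q))
    ...   | yes (z , wz , q , q-int , zq) =
      inj₂ (q , q-int , step (b-avoids i) bw
        (snocʷ (mapʷ free-avoids (outside-C w∉C wz)) zq (interior-avoids q-int)))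
    ...   | no ¬to-int =
      ⊥-elim (w∉C (reverseʷ (spread S (ℕ.m≤m+n 4 1) (WalkIn G U w) extend (here Uw) w∉S seed∉S)))
      where
      S : List (Fin n)
      S = a₁ ∷ a₂ ∷ b i ∷ []

      extend : ∀ {z y} → WalkIn G U w z → Adj G z y → y ∉ S → WalkIn G U w y
      extend {z} {y} wz zy y∉S with y ∈? L
      ... | yes y∈L = ⊥-elim (¬to-int (z , wz , y , (y∈L , (y∉S ∘ here) , (y∉S ∘ there ∘ here)) , zy))
      ... | no  y∉L with y ∈? B
      ...   | no  y∉B = snocʷ wz zy (y∉B , y∉L)
      ...   | yes y∈B with ∈B⇒ y∈B
      ...     | l , refl with l ≟ᶠ i
      ...       | yes refl = ⊥-elim (y∉S (there (there (here refl))))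
      ...       | no  l≢i  = ⊥-elim (¬to-b (z , wz , l , l≢i , Adj-sym zy))

      w∉S : w ∉ S
      w∉S (here refl)                = proj₂ Uw (here refl)
      w∉S (there (here refl))        = proj₂ Uw (last-∈ last)
      w∉S (there (there (here refl))) = Adj-irrefl bw

      seed∉S : seed ∉ S
      seed∉S (here refl)                 = proj₂ seed-free (here refl)
      seed∉S (there (here refl))         = proj₂ seed-free (last-∈ last)
      seed∉S (there (there (here refl))) = proj₁ seed-free (b∈B i)

    reach-interior : ∀ i → ¬ Touches (b i) → Solution ⊎ ReachesInterior (b i)
    reach-interior i ¬ti
      with neighbour-outside (a₁ ∷ a₂ ∷ []) (ℕ.m≤m+n 3 2) {b i} {seed} bi∉ seed∉ bi≢seed
      where
      bi∉ : b i ∉ a₁ ∷ a₂ ∷ []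
      bi∉ (here e)         = a₁∉b i (sym e)
      bi∉ (there (here e)) = a₂∉b i (sym e)
      seed∉ : seed ∉ a₁ ∷ a₂ ∷ []
      seed∉ (here refl)         = proj₂ seed-free (here refl)
      seed∉ (there (here refl)) = proj₂ seed-free (last-∈ last)
      bi≢seed : b i ≢ seed
      bi≢seed e = proj₁ seed-free (subst (_∈ B) e (b∈B i))
    ... | w , bw , w∉ with w ∈? B
    ...   | yes w∈B with ∈B⇒ w∈B
    ...     | l , refl = inj₁ (bridged (λ { refl → Adj-irrefl bw }) (step (b∉L i) bw (here (b∉L l))))
    reach-interior i ¬ti | w , bw , w∉ | no w∉B with w ∈? L
    ...   | yes w∈L = inj₂ (w , w-int , step (b-avoids i) bw (here (interior-avoids w-int)))
      where
      w-int : Interior a₁ a₂ L w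
      w-int = w∈L , (w∉ ∘ here) , (w∉ ∘ there ∘ here)
    ...   | no w∉L = via-free-neighbour i bw (w∉B , w∉L) (λ w∈C → ¬ti (w , w∈C , bw))

    through-C : Touches a₁ → Touches a₂ → Solution
    through-C (x₁ , x₁∈C , a₁x₁) (x₂ , x₂∈C , a₂x₂) with two-of-three (Touches ∘ b) (touches? ∘ b)
    ... | inj₁ (j , k , j≢k , (x , x∈C , bj-x) , (x′ , x′∈C , bk-x′)) =
      bridged j≢k (step (b∉L j) bj-x
        (snocʷ (mapʷ (proj₂ ∘ walk-last) (within-C x∈C x′∈C)) (Adj-sym bk-x′) (b∉L k)))
    ... | inj₂ (j , k , j≢k , ¬tj , ¬tk) with reach-interior j ¬tj | reach-interior k ¬tk
    ...   | inj₁ sol | _        = sol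
    ...   | inj₂ _   | inj₁ sol = sol
    ...   | inj₂ (q , q-int , jq) | inj₂ (q′ , q′-int , kq′) =
      route′ , j , k , j≢k , mapʷ avoids⇒off (jq ++ʷ mapʷ interior-avoids along ++ʷ reverseʷ kq′)
      where
      OnNew : Fin n → Set
      OnNew z = z ≡ a₁ ⊎ z ≡ a₂ ⊎ InC z

      new : InducedPath OnNew a₁ a₂
      new = walk⇒inducedPath (step (inj₁ refl) a₁x₁
              (snocʷ (mapʷ (inj₂ ∘ inj₂) (within-C x₁∈C x₂∈C)) (Adj-sym a₂x₂) (inj₂ (inj₁ refl))))

      open InducedPath new using () renaming (rest to rest′; within to within′)

      on⇒∉B : ∀ {z} → OnNew z → z ∉ B
      on⇒∉B (inj₁ refl)        = ∉B a₁∉b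
      on⇒∉B (inj₂ (inj₁ refl)) = ∉B a₂∉b
      on⇒∉B (inj₂ (inj₂ z∈C))  = proj₁ (walk-last z∈C)

      route′ : Route
      route′ = inducedPath rest′ (InducedPath.chordless new) (InducedPath.last new) (All.map on⇒∉B within′)

      along : WalkIn G (Interior a₁ a₂ L) q q′
      along = interior-connected chordless last q-int q′-int

      avoids⇒off : ∀ {z} → Avoids z → z ∉ a₁ ∷ rest′
      avoids⇒off (z≢a₁ , z≢a₂ , z∉C) z∈ with All.lookup within′ z∈
      ... | inj₁ e           = z≢a₁ e
      ... | inj₂ (inj₁ e)    = z≢a₂ e
      ... | inj₂ (inj₂ z∈C)  = z∉C z∈C

    improve : Improvement
    improve with touches? a₁ | touches? a₂
    ... | no ¬t₁ | _ with first-split touches? L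
    ...   | inj₁ none                = ⊥-elim (some-vertex-touches none)
    ...   | inj₂ (s , untouched-pre) = AtPivot.from-start s untouched-pre ¬t₁
    improve | yes _ | no ¬t₂ with last-split touches? L
    ...   | inj₁ none                 = ⊥-elim (some-vertex-touches none)
    ...   | inj₂ (s , untouched-post) = AtPivot.from-end s untouched-post ¬t₂
    improve | yes t₁ | yes t₂ = inj₁ (through-C t₁ t₂)

  initial : Config
  initial with walk⇒inducedPath (connected-avoiding B (ℕ.m≤m+n 4 1) (∉B a₁∉b) (∉B a₂∉b))
  ... | inducedPath [] _ l _ = ⊥-elim (a₁≢a₂ (last-singleton l))
  ... | r@(inducedPath (x₁ ∷ rest) (cons a₁x₁ _ ¬adj _) _ _)
    with neighbour-outside (x₁ ∷ B) ℕ.≤-refl {a₁} {a₂} a₁∉ a₂∉ a₁≢a₂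
    where
    a₁∉ : a₁ ∉ x₁ ∷ B
    a₁∉ (here e)    = Adj⇒≢ a₁x₁ e
    a₁∉ (there a₁∈) = ∉B a₁∉b a₁∈
    a₂∉ : a₂ ∉ x₁ ∷ B
    a₂∉ (here refl) = ¬a₁a₂ a₁x₁
    a₂∉ (there a₂∈) = ∉B a₂∉b a₂∈
  ...   | c , a₁c , c∉ = config r c ((c∉ ∘ there) , c∉L)
    where
    c∉L : c ∉ a₁ ∷ x₁ ∷ rest
    c∉L (here e)          = Adj⇒≢ a₁c (sym e)
    c∉L (there (here e))  = c∉ (here e)
    c∉L (there (there c∈)) = All.lookup ¬adj c∈ a₁c

  solution : Solution
  solution = bounded-ascent (∣_∣ ∘ component-of) (∣p∣≤n ∘ component-of) Improve.improve initial

induced-path-with-bridge : ∀ {n} (G : Graph n) → KConnected 5 G →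
  (a₁ a₂ : Fin n) (b : Fin 3 → Fin n) →
  a₁ ≢ a₂ → (∀ j → a₁ ≢ b j) → (∀ j → a₂ ≢ b j) → ¬ Adj G a₁ a₂ →
  ∃[ m ] Σ (Fin (suc m) → Fin n) λ p →
    IsInducedPath G p × p zero ≡ a₁ × p (fromℕ m) ≡ a₂
    × (∀ i j → p i ≢ b j)
    × ∃[ j ] ∃[ k ] (j ≢ k × WalkIn G (OffPath p) (b j) (b k))
induced-path-with-bridge G κ a₁ a₂ b a₁≢a₂ a₁∉b a₂∉b ¬a₁a₂
  with Bridging.solution G κ a₁ a₂ b a₁≢a₂ a₁∉b a₂∉b ¬a₁a₂
... | InducedPaths.inducedPath rest ch l off-b , j , k , j≢k , bridge =
  length rest , lookup (a₁ ∷ rest) , chordless⇒IsInducedPath ch , refl , lookup-last l ,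
  (λ i j e → All.lookup off-b (∈-lookup i) (subst (_∈ B) (sym e) (b∈B j))) ,
  j , k , j≢k , Walks.mapʷ G (λ z∉ i e → z∉ (subst (_∈ _) e (∈-lookup i))) bridge
  where
  open InducedPaths G
  open Bridging G κ a₁ a₂ b a₁≢a₂ a₁∉b a₂∉b ¬a₁a₂ using (B; b∈B)

mainTheorem7 : ∀ (n : ℕ) (G : Graph n) → KConnected 5 G →
    (a₁ a₂ : Fin n) (b : Fin 3 → Fin n) →
    a₁ ≢ a₂ → Injective _≡_ _≡_ b → (∀ j → a₁ ≢ b j) → (∀ j → a₂ ≢ b j) →
    (∀ j → Adj G a₁ (b j)) → (∀ j → Adj G a₂ (b j)) →
    ¬ Adj G a₁ a₂ →
    ∃[ m ] Σ (Fin (suc m) → Fin n) λ p →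
      IsInducedPath G p × p zero ≡ a₁ × p (fromℕ m) ≡ a₂
      × (∀ i j → p i ≢ b j)
      × ∃[ j ] ∃[ k ] (j ≢ k × WalkIn G (OffPath p) (b j) (b k))
mainTheorem7 n G κ a₁ a₂ b a₁≢a₂ _ a₁∉b a₂∉b _ _ ¬a₁a₂ =
  induced-path-with-bridge G κ a₁ a₂ b a₁≢a₂ a₁∉b a₂∉b ¬a₁a₂
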